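{- (a) Let $(L,\vee,\wedge,0,1)$ be a bounded lattice equipped, for each $a\in L$, with an antitone involution $x\mapsto x^{a}$ of the section $[a,1]$; write $\mathcal{L}=(L,\vee,\wedge,\{{}^{a}\mid a\in L\},0,1)$. Define, for all $x,y\in L$, $\sim x:=x^{0}$, $x\rightarrow y:=(\sim x\vee\sim y)^{\sim x}$ and $x\odot y:=\sim(y\rightarrow\sim x)=\sim[(x\vee\sim y)^{\sim y}]$. Then $\mathcal{G}(\mathcal{L})=(L,\vee,\wedge,\odot,\rightarrow,0,1)$ is an involutive integral right-residuated l-groupoid with $\rceil x=\sim x$ for all $x$, and its derived implication $\Rightarrow$ satisfies (I3$^{*}$). (b) Let $\mathcal{G}=(L,\vee,\wedge,\odot,\rightarrow,0,1)$ be an involutive integral right-residuated l-groupoid whose derived implication $\Rightarrow$ satisfies (I3$^{*}$), and define $x^{a}:=x\Rightarrow a$ for all $a,x\in L$ with $x\ge a$. Then $\mathcal{L}(\mathcal{G})=(L,\vee,\wedge,\{{}^{a}\mid a\in L\},0,1)$ is a bounded lattice with sectionally antitone involutions $x\mapsto x^{a}$, $x\in[a,1]$, and $x^{0}=x\rightarrow 0$ for all $x\in L$. (c) These constructions are mutually inverse: $\mathcal{G}(\mathcal{L}(\mathcal{G}))=\mathcal{G}$ and $\mathcal{L}(\mathcal{G}(\mathcal{L}))=\mathcal{L}$.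
   Context: A right-residuated l-groupoid is an algebra $(L,\vee,\wedge,\odot,\rightarrow,0,1)$ of type $(2,2,2,2,0,0)$ such that $(L,\vee,\wedge)$ is a lattice with least element $0$ and greatest element $1$, $1\odot x=x$ for all $x$, and $x\odot y\le z$ iff $x\le y\rightarrow z$ for all $x,y,z$. It is integral if $1\odot x=x\odot 1=x$ for all $x$. Put $\rceil x:=x\rightarrow 0$; the groupoid is involutive if $x\mapsto\rceil x$ is antitone and $\rceil\rceil x=x$ for all $x$. The derived implication is $x\Rightarrow y:=\rceil y\rightarrow\rceil x$. Condition (I3$^{*}$) is the identity $(x\Rightarrow y)\Rightarrow y=x\vee y$ for all $x,y$. For $a\in L$, $[a,1]=\{x\mid a\le x\le 1\}$; a sectionally antitone involution is, for each $a$, a mapping $x\mapsto x^{a}$ of $[a,1]$ into itself such that $x\le y$ implies $x^{a}\ge y^{a}$ and $(x^{a})^{a}=x$. -}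

module Defs where

open import Data.Product using (_×_)
open import Function.Bundles using (_⇔_)
open import Relation.Binary.PropositionalEquality using (_≡_)
open import Algebra.Lattice.Structures using (IsLattice)

Op₂ : Set → Set
Op₂ L = L → L → L

Leq : {L : Set} → Op₂ L → L → L → Set
Leq _∧_ x y = x ∧ y ≡ x

record IsBoundedLattice {L : Set} (_∨_ _∧_ : Op₂ L) (𝟘 𝟙 : L) : Set where
  field
    isLattice : IsLattice _≡_ _∨_ _∧_
    𝟘-least   : ∀ x → Leq _∧_ 𝟘 x
    𝟙-greatest : ∀ x → Leq _∧_ x 𝟙

-- Sectional involutions are encoded as a total map  sec : L → L → L,
-- where  sec a x  stands for  x^a ; only its values for a ≤ x matter.
record IsSectionallyAntitoneInvolution {L : Set} (_∧_ : Op₂ L) (𝟙 : L)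
         (sec : L → L → L) : Set where
  field
    into     : ∀ a x → Leq _∧_ a x → Leq _∧_ a (sec a x) × Leq _∧_ (sec a x) 𝟙
    antitone : ∀ a x y → Leq _∧_ a x → Leq _∧_ a y → Leq _∧_ x y →
               Leq _∧_ (sec a y) (sec a x)
    involutive : ∀ a x → Leq _∧_ a x → sec a (sec a x) ≡ x

record IsRightResiduatedLGroupoid {L : Set} (_∨_ _∧_ _⊙_ _⇾_ : Op₂ L) (𝟘 𝟙 : L) : Set where
  field
    isBoundedLattice : IsBoundedLattice _∨_ _∧_ 𝟘 𝟙
    𝟙-identityˡ      : ∀ x → 𝟙 ⊙ x ≡ x
    residuation      : ∀ x y z → Leq _∧_ (x ⊙ y) z ⇔ Leq _∧_ x (y ⇾ z)

neg : {L : Set} → Op₂ L → L → L → L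
neg _⇾_ 𝟘 x = x ⇾ 𝟘

record IsInvIntRRLGroupoid {L : Set} (_∨_ _∧_ _⊙_ _⇾_ : Op₂ L) (𝟘 𝟙 : L) : Set where
  field
    isRRLG      : IsRightResiduatedLGroupoid _∨_ _∧_ _⊙_ _⇾_ 𝟘 𝟙
    𝟙-identityʳ : ∀ x → x ⊙ 𝟙 ≡ x
    neg-antitone : ∀ x y → Leq _∧_ x y → Leq _∧_ (neg _⇾_ 𝟘 y) (neg _⇾_ 𝟘 x)
    neg-involutive : ∀ x → neg _⇾_ 𝟘 (neg _⇾_ 𝟘 x) ≡ x

dimp : {L : Set} → Op₂ L → L → Op₂ L
dimp _⇾_ 𝟘 x y = neg _⇾_ 𝟘 y ⇾ neg _⇾_ 𝟘 x

I3* : {L : Set} → Op₂ L → Op₂ L → L → Set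
I3* _∨_ _⇾_ 𝟘 = ∀ x y → dimp _⇾_ 𝟘 (dimp _⇾_ 𝟘 x y) y ≡ x ∨ y

tilde : {L : Set} → L → (L → L → L) → L → L
tilde 𝟘 sec x = sec 𝟘 x

impL : {L : Set} → Op₂ L → L → (L → L → L) → Op₂ L
impL _∨_ 𝟘 sec x y = sec (tilde 𝟘 sec x) (tilde 𝟘 sec x ∨ tilde 𝟘 sec y)

odotL : {L : Set} → Op₂ L → L → (L → L → L) → Op₂ L
odotL _∨_ 𝟘 sec x y = tilde 𝟘 sec (impL _∨_ 𝟘 sec y (tilde 𝟘 sec x))

secG : {L : Set} → Op₂ L → L → L → L → L
secG _⇾_ 𝟘 a x = dimp _⇾_ 𝟘 x a

PartA : Set₁
PartA = ∀ {L : Set} (_∨_ _∧_ : Op₂ L) (𝟘 𝟙 : L) (sec : L → L → L) →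
  IsBoundedLattice _∨_ _∧_ 𝟘 𝟙 →
  IsSectionallyAntitoneInvolution _∧_ 𝟙 sec →
  IsInvIntRRLGroupoid _∨_ _∧_ (odotL _∨_ 𝟘 sec) (impL _∨_ 𝟘 sec) 𝟘 𝟙
  × (∀ x → neg (impL _∨_ 𝟘 sec) 𝟘 x ≡ tilde 𝟘 sec x)
  × I3* _∨_ (impL _∨_ 𝟘 sec) 𝟘

PartB : Set₁
PartB = ∀ {L : Set} (_∨_ _∧_ _⊙_ _⇾_ : Op₂ L) (𝟘 𝟙 : L) →
  IsInvIntRRLGroupoid _∨_ _∧_ _⊙_ _⇾_ 𝟘 𝟙 →
  I3* _∨_ _⇾_ 𝟘 →
  IsBoundedLattice _∨_ _∧_ 𝟘 𝟙
  × IsSectionallyAntitoneInvolution _∧_ 𝟙 (secG _⇾_ 𝟘)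
  × (∀ x → secG _⇾_ 𝟘 𝟘 x ≡ x ⇾ 𝟘)

-- G(L(G)) = G  (lattice operations and constants are unchanged by
-- construction, so it suffices that ⊙ and → are recovered)
PartC-G : Set₁
PartC-G = ∀ {L : Set} (_∨_ _∧_ _⊙_ _⇾_ : Op₂ L) (𝟘 𝟙 : L) →
  IsInvIntRRLGroupoid _∨_ _∧_ _⊙_ _⇾_ 𝟘 𝟙 →
  I3* _∨_ _⇾_ 𝟘 →
  (∀ x y → odotL _∨_ 𝟘 (secG _⇾_ 𝟘) x y ≡ x ⊙ y)
  × (∀ x y → impL _∨_ 𝟘 (secG _⇾_ 𝟘) x y ≡ x ⇾ y)

-- L(G(L)) = L  (the involutions agree on every section [a,1])
PartC-L : Set₁
PartC-L = ∀ {L : Set} (_∨_ _∧_ : Op₂ L) (𝟘 𝟙 : L) (sec : L → L → L) →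
  IsBoundedLattice _∨_ _∧_ 𝟘 𝟙 →
  IsSectionallyAntitoneInvolution _∧_ 𝟙 sec →
  ∀ a x → Leq _∧_ a x → secG (impL _∨_ 𝟘 sec) 𝟘 a x ≡ sec a x

-- From the sections, x ⇒ y = (y ∨ x)^y and residuation reduces to the symmetric
-- swap y ≤ (a ∨ x)^a ⇔ x ≤ (a ∨ y)^a, so (I3*) is involutivity of ^y.
-- Conversely x^a = x ⇒ a is an involution of [a,1] by (I3*); since ⌉ turns joins
-- into meets, the reconstructed implication is x → (x ∧ y), which is x → y by
-- integrality, and the reconstructed product agrees with ⊙ because left
-- residuals are unique.
module Submission where

open import Defs
open import Data.Product using (_×_; _,_; proj₁)
open import Function.Bundles using (_⇔_; mk⇔; Equivalence)
import Function.Properties.Equivalence as ⇔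
open import Relation.Binary.PropositionalEquality
open import Algebra.Lattice.Bundles using (Lattice)
import Algebra.Lattice.Properties.Lattice as LatticeProperties
open import Algebra.Lattice.Structures using (IsLattice)
import Relation.Binary.Lattice as OrderTheoretic

module BoundedLatticeOrder {L : Set} {_∨_ _∧_ : Op₂ L} {𝟘 𝟙 : L}
                           (B : IsBoundedLattice _∨_ _∧_ 𝟘 𝟙) where
  open IsBoundedLattice B public
  open IsLattice isLattice public using (∨-comm)

  infix 4 _≤_
  _≤_ : L → L → Set
  _≤_ = Leq _∧_

  private
    lattice : Lattice _ _
    lattice = record { _∨_ = _∨_ ; _∧_ = _∧_ ; isLattice = isLattice }

    -- The library orders a lattice by x ≡ x ∧ y, the symmetric form of Leq.
    module O = OrderTheoretic.IsLattice
                 (LatticeProperties.∨-∧-isOrderTheoreticLattice lattice)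

  ≤-refl : ∀ {x} → x ≤ x
  ≤-refl = sym O.refl

  ≤-trans : ∀ {x y z} → x ≤ y → y ≤ z → x ≤ z
  ≤-trans p q = sym (O.trans (sym p) (sym q))

  ≤-antisym : ∀ {x y} → x ≤ y → y ≤ x → x ≡ y
  ≤-antisym p q = O.antisym (sym p) (sym q)

  x≤x∨y : ∀ x y → x ≤ x ∨ y
  x≤x∨y x y = sym (O.x≤x∨y x y)

  y≤x∨y : ∀ x y → y ≤ x ∨ y
  y≤x∨y x y = sym (O.y≤x∨y x y)

  ∨-least : ∀ {x y z} → x ≤ z → y ≤ z → x ∨ y ≤ z
  ∨-least p q = sym (O.∨-least (sym p) (sym q))

  x∧y≤x : ∀ x y → x ∧ y ≤ x
  x∧y≤x x y = sym (O.x∧y≤x x y)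

  x∧y≤y : ∀ x y → x ∧ y ≤ y
  x∧y≤y x y = sym (O.x∧y≤y x y)

  ∧-greatest : ∀ {x y z} → x ≤ y → x ≤ z → x ≤ y ∧ z
  ∧-greatest p q = sym (O.∧-greatest (sym p) (sym q))

  x≤y⇒x∨y≡y : ∀ {x y} → x ≤ y → x ∨ y ≡ y
  x≤y⇒x∨y≡y p = ≤-antisym (∨-least p ≤-refl) (y≤x∨y _ _)

  ≡-by-upperBounds : ∀ {a b} → (∀ w → a ≤ w → b ≤ w) → (∀ w → b ≤ w → a ≤ w) → a ≡ b
  ≡-by-upperBounds f g = ≤-antisym (g _ ≤-refl) (f _ ≤-refl)

  ≡-by-lowerBounds : ∀ {a b} → (∀ w → w ≤ a → w ≤ b) → (∀ w → w ≤ b → w ≤ a) → a ≡ b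
  ≡-by-lowerBounds f g = ≤-antisym (f _ ≤-refl) (g _ ≤-refl)

  residuated-unique : {_⊙_ _⊙′_ _⇾_ : Op₂ L} →
    (∀ x y z → x ⊙ y ≤ z ⇔ x ≤ y ⇾ z) → (∀ x y z → x ⊙′ y ≤ z ⇔ x ≤ y ⇾ z) →
    ∀ x y → x ⊙ y ≡ x ⊙′ y
  residuated-unique res res′ x y = ≡-by-upperBounds
    (λ w h → Equivalence.from (res′ x y w) (Equivalence.to (res x y w) h))
    (λ w h → Equivalence.from (res x y w) (Equivalence.to (res′ x y w) h))

module AntitoneInvolution {L : Set} {_∨_ _∧_ : Op₂ L} {𝟘 𝟙 : L}
                          (B : IsBoundedLattice _∨_ _∧_ 𝟘 𝟙) (f : L → L)
                          (antitone : ∀ {x y} → Leq _∧_ x y → Leq _∧_ (f y) (f x))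
                          (involutive : ∀ x → f (f x) ≡ x) where
  open BoundedLatticeOrder B

  swapʳ : ∀ {x y} → y ≤ f x → x ≤ f y
  swapʳ {x} h = subst (_≤ _) (involutive x) (antitone h)

  swapˡ : ∀ {x y} → f x ≤ y → f y ≤ x
  swapˡ {x} h = subst (_ ≤_) (involutive x) (antitone h)

  antitone⁻¹ : ∀ {x y} → f x ≤ f y → y ≤ x
  antitone⁻¹ {x} {y} h = subst₂ _≤_ (involutive y) (involutive x) (antitone h)

  image-𝟘 : f 𝟘 ≡ 𝟙
  image-𝟘 = ≤-antisym (𝟙-greatest _) (swapʳ (𝟘-least _))

  image-𝟙 : f 𝟙 ≡ 𝟘
  image-𝟙 = ≤-antisym (swapˡ (𝟙-greatest _)) (𝟘-least _)

  deMorgan : ∀ x y → f (f x ∨ f y) ≡ x ∧ y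
  deMorgan x y = ≡-by-lowerBounds
    (λ w h → ∧-greatest (antitone⁻¹ (≤-trans (x≤x∨y _ _) (swapʳ h)))
                         (antitone⁻¹ (≤-trans (y≤x∨y _ _) (swapʳ h))))
    (λ w h → swapʳ (∨-least (antitone (≤-trans h (x∧y≤x x y)))
                            (antitone (≤-trans h (x∧y≤y x y)))))

module SectionalInvolution {L : Set} {_∨_ _∧_ : Op₂ L} {𝟘 𝟙 : L}
                           (B : IsBoundedLattice _∨_ _∧_ 𝟘 𝟙) {sec : L → L → L}
                           (S : IsSectionallyAntitoneInvolution _∧_ 𝟙 sec) where
  open BoundedLatticeOrder B
  open IsSectionallyAntitoneInvolution S public

  ≤-sec : ∀ {a x} → a ≤ x → a ≤ sec a x
  ≤-sec p = proj₁ (into _ _ p)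

  sec-𝟙 : ∀ a → sec a 𝟙 ≡ a
  sec-𝟙 a = ≤-antisym
    (subst (sec a 𝟙 ≤_) (involutive a a ≤-refl)
      (antitone a (sec a a) 𝟙 (≤-sec ≤-refl) (𝟙-greatest a) (𝟙-greatest _)))
    (≤-sec (𝟙-greatest a))

  sec-swap : ∀ {a x y} → a ≤ x → a ≤ y → y ≤ sec a x → x ≤ sec a y
  sec-swap {a} {x} {y} ax ay h =
    subst (_≤ sec a y) (involutive a x ax) (antitone a y (sec a x) ay (≤-sec ax) h)

  -- Joining with a first puts both sides into [a,1]; only then can they be swapped.
  sec-∨-swap : ∀ {a x y} → y ≤ sec a (a ∨ x) → x ≤ sec a (a ∨ y)
  sec-∨-swap {a} {x} {y} h = ≤-trans (y≤x∨y a x)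
    (sec-swap (x≤x∨y a x) (x≤x∨y a y) (∨-least (≤-sec (x≤x∨y a x)) h))

  infix 30 ∼_
  ∼_ : L → L
  ∼ x = tilde 𝟘 sec x

  ∼-antitone : ∀ {x y} → x ≤ y → ∼ y ≤ ∼ x
  ∼-antitone p = antitone 𝟘 _ _ (𝟘-least _) (𝟘-least _) p

  ∼-involutive : ∀ x → ∼ ∼ x ≡ x
  ∼-involutive x = involutive 𝟘 x (𝟘-least x)

  open AntitoneInvolution B ∼_ ∼-antitone ∼-involutive public

module GroupoidOfSections {L : Set} (_∨_ _∧_ : Op₂ L) (𝟘 𝟙 : L) (sec : L → L → L)
                          (B : IsBoundedLattice _∨_ _∧_ 𝟘 𝟙)
                          (S : IsSectionallyAntitoneInvolution _∧_ 𝟙 sec) where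
  open BoundedLatticeOrder B
  open SectionalInvolution B S
  open ≡-Reasoning

  _⇾_ : Op₂ L
  _⇾_ = impL _∨_ 𝟘 sec

  _⊙_ : Op₂ L
  _⊙_ = odotL _∨_ 𝟘 sec

  ⇾𝟘≡∼ : ∀ x → x ⇾ 𝟘 ≡ ∼ x
  ⇾𝟘≡∼ x = begin
    sec (∼ x) (∼ x ∨ ∼ 𝟘)  ≡⟨ cong (λ t → sec (∼ x) (∼ x ∨ t)) image-𝟘 ⟩
    sec (∼ x) (∼ x ∨ 𝟙)    ≡⟨ cong (sec (∼ x)) (x≤y⇒x∨y≡y (𝟙-greatest _)) ⟩
    sec (∼ x) 𝟙            ≡⟨ sec-𝟙 (∼ x) ⟩
    ∼ x                    ∎

  ⊙-unfold : ∀ x y → x ⊙ y ≡ ∼ sec (∼ y) (∼ y ∨ x)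
  ⊙-unfold x y = cong (λ t → ∼ sec (∼ y) (∼ y ∨ t)) (∼-involutive x)

  ⊙-identityˡ : ∀ x → 𝟙 ⊙ x ≡ x
  ⊙-identityˡ x = begin
    𝟙 ⊙ x                    ≡⟨ ⊙-unfold 𝟙 x ⟩
    ∼ sec (∼ x) (∼ x ∨ 𝟙)    ≡⟨ cong (λ t → ∼ sec (∼ x) t) (x≤y⇒x∨y≡y (𝟙-greatest _)) ⟩
    ∼ sec (∼ x) 𝟙            ≡⟨ cong ∼_ (sec-𝟙 (∼ x)) ⟩
    ∼ ∼ x                    ≡⟨ ∼-involutive x ⟩
    x                        ∎

  ⊙-identityʳ : ∀ x → x ⊙ 𝟙 ≡ x
  ⊙-identityʳ x = begin
    x ⊙ 𝟙                    ≡⟨ ⊙-unfold x 𝟙 ⟩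
    ∼ sec (∼ 𝟙) (∼ 𝟙 ∨ x)    ≡⟨ cong (λ t → ∼ sec t (t ∨ x)) image-𝟙 ⟩
    ∼ sec 𝟘 (𝟘 ∨ x)          ≡⟨ cong (λ t → ∼ sec 𝟘 t) (x≤y⇒x∨y≡y (𝟘-least x)) ⟩
    ∼ ∼ x                    ≡⟨ ∼-involutive x ⟩
    x                        ∎

  ⊙-residuation : ∀ x y z → x ⊙ y ≤ z ⇔ x ≤ y ⇾ z
  ⊙-residuation x y z = ⇔.trans
    (subst (λ t → t ≤ z ⇔ ∼ z ≤ sec (∼ y) (∼ y ∨ x)) (sym (⊙-unfold x y))
      (mk⇔ swapˡ swapˡ))
    (mk⇔ sec-∨-swap sec-∨-swap)

  isInvIntRRLGroupoid : IsInvIntRRLGroupoid _∨_ _∧_ _⊙_ _⇾_ 𝟘 𝟙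
  isInvIntRRLGroupoid = record
    { isRRLG = record
      { isBoundedLattice = B
      ; 𝟙-identityˡ      = ⊙-identityˡ
      ; residuation      = ⊙-residuation
      }
    ; 𝟙-identityʳ    = ⊙-identityʳ
    ; neg-antitone   = λ x y p → subst₂ _≤_ (sym (⇾𝟘≡∼ y)) (sym (⇾𝟘≡∼ x)) (∼-antitone p)
    ; neg-involutive = λ x → trans (⇾𝟘≡∼ (x ⇾ 𝟘)) (trans (cong ∼_ (⇾𝟘≡∼ x)) (∼-involutive x))
    }

  ⇒-unfold : ∀ x y → dimp _⇾_ 𝟘 x y ≡ sec y (y ∨ x)
  ⇒-unfold x y = begin
    (y ⇾ 𝟘) ⇾ (x ⇾ 𝟘)  ≡⟨ cong₂ _⇾_ (⇾𝟘≡∼ y) (⇾𝟘≡∼ x) ⟩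
    ∼ y ⇾ ∼ x          ≡⟨ cong₂ (λ s t → sec s (s ∨ t)) (∼-involutive y) (∼-involutive x) ⟩
    sec y (y ∨ x)      ∎

  ⇒-I3* : I3* _∨_ _⇾_ 𝟘
  ⇒-I3* x y = begin
    dimp _⇾_ 𝟘 (dimp _⇾_ 𝟘 x y) y  ≡⟨ ⇒-unfold _ y ⟩
    sec y (y ∨ dimp _⇾_ 𝟘 x y)     ≡⟨ cong (λ t → sec y (y ∨ t)) (⇒-unfold x y) ⟩
    sec y (y ∨ sec y (y ∨ x))      ≡⟨ cong (sec y) (x≤y⇒x∨y≡y (≤-sec y≤y∨x)) ⟩
    sec y (sec y (y ∨ x))          ≡⟨ involutive y (y ∨ x) y≤y∨x ⟩
    y ∨ x                          ≡⟨ ∨-comm y x ⟩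
    x ∨ y                          ∎
    where y≤y∨x = x≤x∨y y x

  secG-⇾ : ∀ a x → a ≤ x → secG _⇾_ 𝟘 a x ≡ sec a x
  secG-⇾ a x p = trans (⇒-unfold x a) (cong (sec a) (x≤y⇒x∨y≡y p))

module SectionsOfGroupoid {L : Set} (_∨_ _∧_ _⊙_ _⇾_ : Op₂ L) (𝟘 𝟙 : L)
                          (G : IsInvIntRRLGroupoid _∨_ _∧_ _⊙_ _⇾_ 𝟘 𝟙)
                          (I : I3* _∨_ _⇾_ 𝟘) where
  open IsInvIntRRLGroupoid G
  open IsRightResiduatedLGroupoid isRRLG public using (isBoundedLattice)
  open IsRightResiduatedLGroupoid isRRLG using (𝟙-identityˡ; residuation)
  open BoundedLatticeOrder isBoundedLattice
  open ≡-Reasoning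

  ⇾-intro : ∀ {x y z} → x ⊙ y ≤ z → x ≤ y ⇾ z
  ⇾-intro = Equivalence.to (residuation _ _ _)

  ⇾-elim : ∀ {x y z} → x ≤ y ⇾ z → x ⊙ y ≤ z
  ⇾-elim = Equivalence.from (residuation _ _ _)

  ⊙-monoˡ : ∀ {x x′ y} → x ≤ x′ → x ⊙ y ≤ x′ ⊙ y
  ⊙-monoˡ p = ⇾-elim (≤-trans p (⇾-intro ≤-refl))

  ⇾-monoʳ : ∀ {y z z′} → z ≤ z′ → y ⇾ z ≤ y ⇾ z′
  ⇾-monoʳ p = ⇾-intro (≤-trans (⇾-elim ≤-refl) p)

  x⊙y≤y : ∀ x y → x ⊙ y ≤ y
  x⊙y≤y x y = subst (x ⊙ y ≤_) (𝟙-identityˡ y) (⊙-monoˡ (𝟙-greatest x))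

  𝟙⇾x≡x : ∀ x → 𝟙 ⇾ x ≡ x
  𝟙⇾x≡x x = ≡-by-lowerBounds
    (λ w h → subst (_≤ x) (𝟙-identityʳ w) (⇾-elim h))
    (λ w h → ⇾-intro (subst (_≤ x) (sym (𝟙-identityʳ w)) h))

  infix 30 ⌉_
  ⌉_ : L → L
  ⌉ x = neg _⇾_ 𝟘 x

  open AntitoneInvolution isBoundedLattice ⌉_ (neg-antitone _ _) neg-involutive

  ⇾-∧ : ∀ x y → x ⇾ (x ∧ y) ≡ x ⇾ y
  ⇾-∧ x y = ≤-antisym (⇾-monoʳ (x∧y≤y x y))
                      (⇾-intro (∧-greatest (x⊙y≤y _ x) (⇾-elim ≤-refl)))

  secG-𝟘 : ∀ x → secG _⇾_ 𝟘 𝟘 x ≡ ⌉ x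
  secG-𝟘 x = trans (cong (_⇾ ⌉ x) image-𝟘) (𝟙⇾x≡x (⌉ x))

  ≤-⇒ : ∀ a x → a ≤ dimp _⇾_ 𝟘 x a
  ≤-⇒ a x = ⇾-intro (≤-trans (⇾-elim (swapʳ ≤-refl)) (𝟘-least (⌉ x)))

  isSectionallyAntitoneInvolution : IsSectionallyAntitoneInvolution _∧_ 𝟙 (secG _⇾_ 𝟘)
  isSectionallyAntitoneInvolution = record
    { into       = λ a x _ → ≤-⇒ a x , 𝟙-greatest _
    ; antitone   = λ a x y _ _ p → ⇾-monoʳ (neg-antitone x y p)
    ; involutive = λ a x a≤x →
        trans (I x a) (trans (∨-comm x a) (x≤y⇒x∨y≡y a≤x))
    }

  impL-secG : ∀ x y → impL _∨_ 𝟘 (secG _⇾_ 𝟘) x y ≡ x ⇾ y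
  impL-secG x y = begin
    impL _∨_ 𝟘 (secG _⇾_ 𝟘) x y  ≡⟨ cong₂ (λ s t → secG _⇾_ 𝟘 s (s ∨ t)) (secG-𝟘 x) (secG-𝟘 y) ⟩
    ⌉ ⌉ x ⇾ ⌉ (⌉ x ∨ ⌉ y)       ≡⟨ cong₂ _⇾_ (neg-involutive x) (deMorgan x y) ⟩
    x ⇾ (x ∧ y)                 ≡⟨ ⇾-∧ x y ⟩
    x ⇾ y                       ∎

  private
    module Reconstructed = GroupoidOfSections _∨_ _∧_ 𝟘 𝟙 (secG _⇾_ 𝟘)
                             isBoundedLattice isSectionallyAntitoneInvolution

  odotL-secG : ∀ x y → odotL _∨_ 𝟘 (secG _⇾_ 𝟘) x y ≡ x ⊙ y
  odotL-secG = residuated-unique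
    (λ x y z → subst (λ t → x Reconstructed.⊙ y ≤ z ⇔ x ≤ t) (impL-secG y z)
                          (Reconstructed.⊙-residuation x y z))
    residuation

theorem3 : PartA × PartB × PartC-G × PartC-L
theorem3 =
    (λ _∨_ _∧_ 𝟘 𝟙 sec B S → let open GroupoidOfSections _∨_ _∧_ 𝟘 𝟙 sec B S in
       isInvIntRRLGroupoid , ⇾𝟘≡∼ , ⇒-I3*)
  , (λ _∨_ _∧_ _⊙_ _⇾_ 𝟘 𝟙 G I → let open SectionsOfGroupoid _∨_ _∧_ _⊙_ _⇾_ 𝟘 𝟙 G I in
       isBoundedLattice , isSectionallyAntitoneInvolution , secG-𝟘)
  , (λ _∨_ _∧_ _⊙_ _⇾_ 𝟘 𝟙 G I → let open SectionsOfGroupoid _∨_ _∧_ _⊙_ _⇾_ 𝟘 𝟙 G I in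
       odotL-secG , impL-secG)
  , (λ _∨_ _∧_ 𝟘 𝟙 sec B S → GroupoidOfSections.secG-⇾ _∨_ _∧_ 𝟘 𝟙 sec B S)
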